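{- Let $I_t$ denote the matching with $t$ edges (i.e. $t$ pairwise vertex-disjoint edges). Then, as $n\to\infty$: (i) $C(n,I_4)=\Omega(n^{1/5})$; (ii) $C(n,I_t)=\Omega(n^{1/3})$ for $t\in\{5,6\}$; (iii) $C(n,I_t)=\Omega(n^{1/2})$ for every $t\geqslant 7$.
   Context: For a graph $H$ and a positive integer $n$, $C(n,H)$ denotes the minimum integer $k$ such that there exist $n$ colorings $f_v:E(K_n)\to[k]$, one for each vertex $v\in V(K_n)$ (the colorings need not be proper), with the following property: for every copy $T$ of $H$ in $K_n$, there is a vertex $v\in V(T)$ such that $f_v$ assigns pairwise distinct colors to all edges of $E(T)$. -}

module Defs where

open import Data.Nat using (ℕ; _≤_; _*_; _^_)
open import Data.Fin using (Fin; zero; suc)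
open import Data.Product using (_×_; Σ; ∃; ∃-syntax; _,_)
open import Relation.Binary.PropositionalEquality using (_≡_; _≢_)
open import Relation.Nullary using (¬_)
open import Function.Definitions using (Injective)

-- An edge colouring of K_n with k colours: a symmetric function on pairs
-- of vertices (the value on the diagonal is irrelevant, loops are not edges).
record EdgeColouring (n k : ℕ) : Set where
  field
    col : Fin n → Fin n → Fin k
    sym : ∀ a b → col a b ≡ col b a
open EdgeColouring public

-- A copy of the matching I_t in K_n: an injective map from the 2t vertices
-- of I_t (vertex (i , 0) and (i , 1) are the ends of the i-th edge) to V(K_n).
record MatchingCopy (n t : ℕ) : Set where
  field
    emb : Fin t × Fin 2 → Fin n
    inj : Injective _≡_ _≡_ emb
open MatchingCopy public

end₀ end₁ : ∀ {n t} → MatchingCopy n t → Fin t → Fin n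
end₀ T i = emb T (i , zero)
end₁ T i = emb T (i , suc zero)

InCopy : ∀ {n t} → Fin n → MatchingCopy n t → Set
InCopy v T = ∃[ p ] emb T p ≡ v

Rainbow : ∀ {n k t} → EdgeColouring n k → MatchingCopy n t → Set
Rainbow c T = ∀ i j → i ≢ j → col c (end₀ T i) (end₁ T i) ≢ col c (end₀ T j) (end₁ T j)

Works : (n t k : ℕ) → Set
Works n t k = Σ (Fin n → EdgeColouring n k) λ f →
  (T : MatchingCopy n t) → ∃[ v ] (InCopy v T × Rainbow (f v) T)

-- C(n, I_t) = Ω(n^(1/d)):  ∃ c > 0, N, ∀ n ≥ N, C(n,I_t) ≥ c n^(1/d).
-- Since C(n,I_t) is the least k with Works n t k, "C(n,I_t) ≥ x" means every
-- working k is ≥ x; and k ≥ c n^(1/d) ⇔ n ≤ c^(-d) k^d, with c^(-d) bounded by a natural q.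
LowerBoundRoot : (t d : ℕ) → Set
LowerBoundRoot t d = ∃[ q ] ∃[ N ] ∀ n → N ≤ n → ∀ k → Works n t k → n ≤ q * k ^ d

-- Let m = 2k and split the vertices into m disjoint pairs and R further vertices. Each
-- further vertex w colours the m pairs with only k colours, so at least k pairs share
-- their f_w-colour with another pair; averaging twice gives two pairs e₀, e₁ coloured
-- alike by at least R/(8k) further vertices, which we group into P edges. The four
-- endpoints of e₀, e₁ colour these P edges. Merged into r colourings with K colours,
-- (r, K) = (1, k⁴), (2, k²) or (4, k), they admit, as soon as P > rK, an edge x which under
-- every merged colouring i, hence under each of the four, repeats the colour of an edge yᵢ.
-- A matching made of e₀, e₁ and t − 2 ≥ r + 1 of the P edges, including x and all yᵢ, then
-- has no rainbow vertex. Hence R < 8kP, and n = O(kK) is O(k⁵), O(k³) or O(k²).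

module Submission where

open import Defs hiding (sym)
open import Data.Nat using (ℕ; zero; suc; _+_; _*_; _^_; _∸_; _≤_; _<_; z≤n; s≤s; _≤?_; NonZero; >-nonZero⁻¹)
open import Data.Nat.Properties
  using (≤-refl; ≤-trans; ≤-reflexive; ≤-pred; <⇒≤; ≰⇒>; ≮⇒≥; n≤1+n; n<1+n; m≤m+n; m≤n+m; m≤m*n;
         +-mono-≤; +-monoʳ-≤; +-cancelˡ-≤; +-cancelʳ-≤; *-monoˡ-≤; *-monoʳ-≤; *-cancelˡ-≤;
         *-identityʳ; *-assoc; m+[n∸m]≡n; m*n≢0; m^n≢0; +-0-commutativeMonoid; module ≤-Reasoning)
open import Algebra.Properties.CommutativeMonoid.Sum +-0-commutativeMonoid
  using (sum; sum-cong-≗; ∑-comm; ∑-distrib-+)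
open import Data.Nat.Tactic.RingSolver using (solve-∀)
open import Data.Fin using (Fin; zero; suc; _↑ˡ_; _↑ʳ_; _≟_; inject≤; splitAt; combine; remQuot)
open import Data.Fin.Properties
  using (any?; pigeonhole; suc-injective; ↑ˡ-injective; ↑ʳ-injective; inject≤-injective;
         splitAt-↑ˡ; splitAt-↑ʳ; splitAt⁻¹-↑ˡ; splitAt⁻¹-↑ʳ; combine-injective; remQuot-combine)
  renaming (<⇒≢ to <⇒≢ᶠ)
open import Data.Product using (Σ-syntax; ∃; ∃₂; ∃-syntax; _×_; _,_; proj₁; proj₂)
open import Data.Product.Properties using (,-injective)
open import Data.Sum using (_⊎_; inj₁; inj₂)
open import Data.Sum.Properties using (inj₁-injective; inj₂-injective)
open import Relation.Nullary using (¬_; Dec; yes; no; contradiction)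
open import Relation.Nullary.Decidable using (¬?; _×-dec_; decidable-stable)
open import Relation.Unary using (Pred; Decidable)
open import Relation.Binary.PropositionalEquality
  using (_≡_; _≢_; refl; sym; trans; cong; cong₂; subst; module ≡-Reasoning)
open import Function using (id; _∘_)
open import Function.Definitions using (Injective)

sum-mono-≤ : ∀ {N} {a b : Fin N → ℕ} → (∀ x → a x ≤ b x) → sum a ≤ sum b
sum-mono-≤ {zero}  a≤b = z≤n
sum-mono-≤ {suc N} a≤b = +-mono-≤ (a≤b zero) (sum-mono-≤ (a≤b ∘ suc))

sum-const : ∀ N c → sum {N} (λ _ → c) ≡ N * c
sum-const zero    c = refl
sum-const (suc N) c = cong (c +_) (sum-const N c)

argmax : ∀ {N} .{{_ : NonZero N}} (a : Fin N → ℕ) → ∃[ i ] ∀ j → a j ≤ a i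
argmax {suc zero} a = zero , λ { zero → ≤-refl }
argmax {suc (suc N)} a with i , max ← argmax (a ∘ suc) | a (suc i) ≤? a zero
... | yes ≤a₀ = zero , λ { zero → ≤-refl ; (suc j) → ≤-trans (max j) ≤a₀ }
... | no ≰a₀  = suc i , λ { zero → <⇒≤ (≰⇒> ≰a₀) ; (suc j) → max j }

∃-≥-average : ∀ {N} .{{_ : NonZero N}} (a : Fin N → ℕ) → ∃[ i ] sum a ≤ N * a i
∃-≥-average {N} a with i , max ← argmax a = i , ≤-trans (sum-mono-≤ max) (≤-reflexive (sum-const N (a i)))

indicator : ∀ {p} {P : Set p} → Dec P → ℕ
indicator (yes _) = 1
indicator (no _)  = 0

count : ∀ {N p} {P : Pred (Fin N) p} → Decidable P → ℕ
count P? = sum (λ x → indicator (P? x))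

indicator-¬ : ∀ {p} {P : Set p} (P? : Dec P) → indicator P? + indicator (¬? P?) ≡ 1
indicator-¬ (yes _) = refl
indicator-¬ (no _)  = refl

count+count¬ : ∀ {N p} {P : Pred (Fin N) p} (P? : Decidable P) → count P? + count (¬? ∘ P?) ≡ N
count+count¬ {N} P? = begin
  count P? + count (¬? ∘ P?)                           ≡⟨ ∑-distrib-+ (indicator ∘ P?) (indicator ∘ ¬? ∘ P?) ⟨
  sum (λ x → indicator (P? x) + indicator (¬? (P? x))) ≡⟨ sum-cong-≗ (indicator-¬ ∘ P?) ⟩
  sum {N} (λ _ → 1)                                    ≡⟨ sum-const N 1 ⟩
  N * 1                                                ≡⟨ *-identityʳ N ⟩
  N                                                    ∎
  where open ≡-Reasoning

count<⇒∃¬ : ∀ {N p} {P : Pred (Fin N) p} (P? : Decidable P) → count P? < N → ∃[ x ] ¬ P x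
count<⇒∃¬ {suc N} P? lt with P? zero
... | no ¬p = zero , ¬p
... | yes _ with x , ¬p ← count<⇒∃¬ (P? ∘ suc) (≤-pred lt) = suc x , ¬p

≤count⇒injection : ∀ {N p} {P : Pred (Fin N) p} (P? : Decidable P) s → s ≤ count P? →
          Σ[ g ∈ (Fin s → Fin N) ] Injective _≡_ _≡_ g × (∀ l → P (g l))
≤count⇒injection P? zero _ = (λ ()) , (λ {}) , λ ()
≤count⇒injection {suc N} {P = P} P? (suc s) s≤ with P? zero
... | yes p with g , g-inj , g-P ← ≤count⇒injection (P? ∘ suc) s (≤-pred s≤) = g′ , g′-inj , g′-P
  where
  g′ : Fin (suc s) → Fin (suc N)
  g′ zero    = zero
  g′ (suc l) = suc (g l)
  g′-inj : Injective _≡_ _≡_ g′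
  g′-inj {zero}  {zero}  _  = refl
  g′-inj {suc _} {suc _} eq = cong suc (g-inj (suc-injective eq))
  g′-P : ∀ l → P (g′ l)
  g′-P zero    = p
  g′-P (suc l) = g-P l
... | no _ with g , g-inj , g-P ← ≤count⇒injection (P? ∘ suc) (suc s) s≤ = suc ∘ g , g-inj ∘ suc-injective , g-P

injective⇒≤ : ∀ {s K} (h : Fin s → Fin K) → Injective _≡_ _≡_ h → s ≤ K
injective⇒≤ {s} {K} h h-inj with s ≤? K
... | yes s≤K = s≤K
... | no s≰K with i , j , i<j , eq ← pigeonhole (≰⇒> s≰K) h = contradiction (h-inj eq) (<⇒≢ᶠ i<j)

count≤-injectiveOn : ∀ {N K p} {P : Pred (Fin N) p} (P? : Decidable P) (c : Fin N → Fin K) →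
                     (∀ {x y} → P x → P y → c x ≡ c y → x ≡ y) → count P? ≤ K
count≤-injectiveOn P? c c-inj with g , g-inj , g-P ← ≤count⇒injection P? (count P?) ≤-refl =
  injective⇒≤ (c ∘ g) (λ {x} {y} eq → g-inj (c-inj (g-P x) (g-P y) eq))

count≤∑count : ∀ {N r p q} {Q : Pred (Fin N) q} {R : Fin r → Pred (Fin N) p}
               (Q? : Decidable Q) (R? : ∀ i → Decidable (R i)) → (∀ x → Q x → ∃[ i ] R i x) →
               count Q? ≤ sum (λ i → count (R? i))
count≤∑count Q? R? Q⊆∪R = ≤-trans (sum-mono-≤ pointwise) (≤-reflexive (∑-comm λ x i → indicator (R? i x)))
  where
  union-bound : ∀ {r} {R : Fin r → Set _} (R? : ∀ i → Dec (R i)) → ∃ R → 1 ≤ sum (λ i → indicator (R? i))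
  union-bound R? (zero , Rᵢ) with R? zero
  ... | yes _ = s≤s z≤n
  ... | no ¬Rᵢ = contradiction Rᵢ ¬Rᵢ
  union-bound R? (suc i , Rᵢ) = ≤-trans (union-bound (R? ∘ suc) (i , Rᵢ)) (m≤n+m _ _)
  pointwise : ∀ x → indicator (Q? x) ≤ sum (λ i → indicator (R? i x))
  pointwise x with Q? x
  ... | no _  = z≤n
  ... | yes q = union-bound (λ i → R? i x) (Q⊆∪R x q)

Mate : ∀ {P K} → (Fin P → Fin K) → Fin P → Fin P → Set
Mate c x y = y ≢ x × c y ≡ c x

HasMate : ∀ {P K} → (Fin P → Fin K) → Fin P → Set
HasMate c x = ∃ (Mate c x)

mate? : ∀ {P K} (c : Fin P → Fin K) x → Decidable (Mate c x)
mate? c x y = ¬? (y ≟ x) ×-dec (c y ≟ c x)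

hasMate? : ∀ {P K} (c : Fin P → Fin K) → Decidable (HasMate c)
hasMate? c x = any? (mate? c x)

lonely-count≤ : ∀ {P K} (c : Fin P → Fin K) → count (¬? ∘ hasMate? c) ≤ K
lonely-count≤ c = count≤-injectiveOn (¬? ∘ hasMate? c) c lonely-injective
  where
  lonely-injective : ∀ {x y} → ¬ HasMate c x → ¬ HasMate c y → c x ≡ c y → x ≡ y
  lonely-injective {x} {y} x-lonely _ cx≡cy with y ≟ x
  ... | yes y≡x = sym y≡x
  ... | no y≢x  = contradiction (y , y≢x , sym cx≡cy) x-lonely

≤count-hasMate+ : ∀ {P K} (c : Fin P → Fin K) → P ≤ count (hasMate? c) + K
≤count-hasMate+ {P} c = begin
  P                                                 ≡⟨ count+count¬ (hasMate? c) ⟨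
  count (hasMate? c) + count (¬? ∘ hasMate? c)      ≤⟨ +-monoʳ-≤ _ (lonely-count≤ c) ⟩
  count (hasMate? c) + _                            ∎
  where open ≤-Reasoning

common-mate : ∀ {r P K} (c : Fin r → Fin P → Fin K) → r * K < P → ∃[ x ] ∀ i → HasMate (c i) x
common-mate {r} {P} {K} c r*K<P =
  let x , ¬somewhere-lonely = count<⇒∃¬ somewhere-lonely? few-somewhere-lonely
  in x , λ i → decidable-stable (hasMate? (c i) x) (¬somewhere-lonely ∘ (i ,_))
  where
  somewhere-lonely? : Decidable (λ x → ∃[ i ] ¬ HasMate (c i) x)
  somewhere-lonely? x = any? (λ i → ¬? (hasMate? (c i) x))
  few-somewhere-lonely : count somewhere-lonely? < P
  few-somewhere-lonely = begin-strict
    count somewhere-lonely?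
      ≤⟨ count≤∑count somewhere-lonely? (λ i → ¬? ∘ hasMate? (c i)) (λ _ lonely → lonely) ⟩
    sum (λ i → count (¬? ∘ hasMate? (c i)))         ≤⟨ sum-mono-≤ (lonely-count≤ ∘ c) ⟩
    sum {r} (λ _ → K)                               ≡⟨ sum-const r K ⟩
    r * K                                           <⟨ r*K<P ⟩
    P                                               ∎
    where open ≤-Reasoning

popular-pair : ∀ {R m k} d .{{_ : NonZero m}} (h : Fin R → Fin m → Fin k) → d + k ≤ m →
               ∃₂ λ i j → R * d ≤ m * m * count (λ w → mate? (h w) i j)
popular-pair {R} {m} {k} d h d+k≤m
  with i , i-popular ← ∃-≥-average (λ i → count (λ w → hasMate? (h w) i))
  with j , j-popular ← ∃-≥-average (λ j → count (λ w → mate? (h w) i j)) =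
  i , j , (begin
    R * d                                                   ≡⟨ sum-const R d ⟨
    sum {R} (λ _ → d)                                       ≤⟨ sum-mono-≤ many-mated ⟩
    sum (λ w → count (hasMate? (h w)))                      ≡⟨ ∑-comm (λ w i → indicator (hasMate? (h w) i)) ⟩
    sum (λ i → count (λ w → hasMate? (h w) i))              ≤⟨ i-popular ⟩
    m * count (λ w → hasMate? (h w) i)
      ≤⟨ *-monoʳ-≤ m (count≤∑count _ (λ j w → mate? (h w) i j) (λ _ mated → mated)) ⟩
    m * sum (λ j → count (λ w → mate? (h w) i j))           ≤⟨ *-monoʳ-≤ m j-popular ⟩
    m * (m * count (λ w → mate? (h w) i j))                 ≡⟨ *-assoc m m _ ⟨
    m * m * count (λ w → mate? (h w) i j)                   ∎)
  where
  open ≤-Reasoning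
  many-mated : ∀ w → d ≤ count (hasMate? (h w))
  many-mated w = +-cancelʳ-≤ k d _ (≤-trans d+k≤m (≤count-hasMate+ (h w)))

DeterminedBy : ∀ {X A B : Set} → (X → A) → (X → B) → Set
DeterminedBy φ c = ∀ x y → c x ≡ c y → φ x ≡ φ y

determinedBy-trans : ∀ {X A B C : Set} {φ : X → A} {c : X → B} {d : X → C} →
                     DeterminedBy φ c → DeterminedBy c d → DeterminedBy φ d
determinedBy-trans φ≼c c≼d x y = φ≼c x y ∘ c≼d x y

determinedBy-combineˡ : ∀ {X m n} (a : X → Fin m) (b : X → Fin n) → DeterminedBy a (λ x → combine (a x) (b x))
determinedBy-combineˡ a b x y = proj₁ ∘ combine-injective (a x) (b x) (a y) (b y)

determinedBy-combineʳ : ∀ {X m n} (a : X → Fin m) (b : X → Fin n) → DeterminedBy b (λ x → combine (a x) (b x))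
determinedBy-combineʳ a b x y = proj₂ ∘ combine-injective (a x) (b x) (a y) (b y)

Encodes : ℕ → ℕ → ℕ → Set
Encodes r K k = ∀ {P} (φ : Fin 2 × Fin 2 → Fin P → Fin k) →
  Σ[ c ∈ (Fin r → Fin P → Fin K) ] ∀ v → ∃[ i ] DeterminedBy (φ v) (c i)

encodes-identity : ∀ {k} → Encodes 4 k k
encodes-identity φ = (λ i → φ (remQuot 2 i)) , λ (a , b) →
  combine a b , subst (λ v → DeterminedBy (φ (a , b)) (φ v)) (sym (remQuot-combine a b)) (λ _ _ → id)

encodes-halve : ∀ {r K k} → Encodes (r + r) K k → Encodes r (K * K) k
encodes-halve {r} {K} {k} enc {P} φ = merged , λ v → merge (proj₂ (enc φ) v)
  where
  c : Fin (r + r) → Fin P → Fin K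
  c = proj₁ (enc φ)
  merged : Fin r → Fin P → Fin (K * K)
  merged i p = combine (c (i ↑ˡ r) p) (c (r ↑ʳ i) p)
  merge : ∀ {ψ : Fin P → Fin k} → ∃[ j ] DeterminedBy ψ (c j) → ∃[ i ] DeterminedBy ψ (merged i)
  merge (j , ψ≼cⱼ) with splitAt r j in eq
  ... | inj₁ i = i , determinedBy-trans (subst (DeterminedBy _ ∘ c) (sym (splitAt⁻¹-↑ˡ eq)) ψ≼cⱼ)
                                        (determinedBy-combineˡ (c (i ↑ˡ r)) (c (r ↑ʳ i)))
  ... | inj₂ i = i , determinedBy-trans (subst (DeterminedBy _ ∘ c) (sym (splitAt⁻¹-↑ʳ eq)) ψ≼cⱼ)
                                        (determinedBy-combineʳ (c (i ↑ˡ r)) (c (r ↑ʳ i)))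

↑ˡ≢↑ʳ : ∀ {m n} (i : Fin m) (j : Fin n) → i ↑ˡ n ≢ m ↑ʳ j
↑ˡ≢↑ʳ {m} {n} i j eq with () ← trans (sym (splitAt-↑ˡ m i n)) (trans (cong (splitAt m) eq) (splitAt-↑ʳ m n j))

-- Every value of σ is a value of L or lies in the padding block, which keeps any new value of L fresh.
padded-injection-through : ∀ {M U a u} → a ≤ u → u ≤ U → (L : Fin a → Fin M) →
  Σ[ σ ∈ (Fin u → Fin (M + U)) ] Injective _≡_ _≡_ σ × (∀ j → ∃[ l ] σ l ≡ L j ↑ˡ U)
    × (∀ l → (∃[ j ] σ l ≡ L j ↑ˡ U) ⊎ (∃[ z ] σ l ≡ M ↑ʳ z))
padded-injection-through {M} {a = zero} _ u≤U L =
  (λ l → M ↑ʳ inject≤ l u≤U) ,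
  (λ eq → inject≤-injective u≤U u≤U _ _ (↑ʳ-injective M _ _ eq)) ,
  (λ ()) , λ l → inj₂ (_ , refl)
padded-injection-through {M} {U} {suc a} a<u u≤U L with any? (λ j → L zero ≟ L (suc j))
... | yes (j , L₀≡Lⱼ) with σ , σ-inj , covers , values ← padded-injection-through (≤-trans (n≤1+n a) a<u) u≤U (L ∘ suc) =
  σ , σ-inj , covers′ , values′
  where
  covers′ : ∀ j → ∃[ l ] σ l ≡ L j ↑ˡ U
  covers′ zero with l , σl≡ ← covers j = l , trans σl≡ (cong (_↑ˡ U) (sym L₀≡Lⱼ))
  covers′ (suc j) = covers j
  values′ : ∀ l → (∃[ j ] σ l ≡ L j ↑ˡ U) ⊎ (∃[ z ] σ l ≡ M ↑ʳ z)
  values′ l with values l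
  ... | inj₁ (j , σl≡) = inj₁ (suc j , σl≡)
  ... | inj₂ padding   = inj₂ padding
padded-injection-through {M} {U} {suc a} {suc u} (s≤s a≤u) u≤U L | no L₀-new
  with σ , σ-inj , covers , values ← padded-injection-through a≤u (≤-trans (n≤1+n u) u≤U) (L ∘ suc) =
  σ′ , σ′-inj , covers′ , values′
  where
  σ′ : Fin (suc u) → Fin (M + U)
  σ′ zero    = L zero ↑ˡ U
  σ′ (suc l) = σ l
  fresh : ∀ l → L zero ↑ˡ U ≢ σ l
  fresh l eq with values l
  ... | inj₁ (j , σl≡) = L₀-new (j , ↑ˡ-injective U _ _ (trans eq σl≡))
  ... | inj₂ (z , σl≡) = ↑ˡ≢↑ʳ (L zero) z (trans eq σl≡)
  σ′-inj : Injective _≡_ _≡_ σ′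
  σ′-inj {zero}  {zero}  _  = refl
  σ′-inj {zero}  {suc y} eq = contradiction eq (fresh y)
  σ′-inj {suc x} {zero}  eq = contradiction (sym eq) (fresh x)
  σ′-inj {suc x} {suc y} eq = cong suc (σ-inj eq)
  covers′ : ∀ j → ∃[ l ] σ′ l ≡ L j ↑ˡ U
  covers′ zero    = zero , refl
  covers′ (suc j) with l , σl≡ ← covers j = suc l , σl≡
  values′ : ∀ l → (∃[ j ] σ′ l ≡ L j ↑ˡ U) ⊎ (∃[ z ] σ′ l ≡ M ↑ʳ z)
  values′ zero = inj₁ (zero , refl)
  values′ (suc l) with values l
  ... | inj₁ (j , σl≡) = inj₁ (suc j , σl≡)
  ... | inj₂ padding   = inj₂ padding

injection-through : ∀ {M a u} → a ≤ u → (L : Fin a → Fin M) →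
  Σ[ σ ∈ (Fin u → Fin (M + u)) ] Injective _≡_ _≡_ σ × (∀ j → ∃[ l ] σ l ≡ L j ↑ˡ u)
injection-through a≤u L = let σ , σ-inj , covers , _ = padded-injection-through a≤u ≤-refl L in σ , σ-inj , covers

Repeats : ∀ {u} {A : Set} → (Fin u → A) → Set
Repeats χ = ∃₂ λ l l′ → l ≢ l′ × χ l ≡ χ l′

repeats-∘ : ∀ {u v} {A : Set} {χ : Fin v → A} {s : Fin u → Fin v} →
            Injective _≡_ _≡_ s → Repeats (χ ∘ s) → Repeats χ
repeats-∘ s-inj (l , l′ , l≢l′ , same) = _ , _ , l≢l′ ∘ s-inj , same

repeating-subfamily : ∀ {r K k u} → Encodes r K k → r < u → (φ : Fin 2 × Fin 2 → Fin (suc (r * K) + u) → Fin k) →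
  Σ[ σ ∈ (Fin u → Fin (suc (r * K) + u)) ] Injective _≡_ _≡_ σ × (∀ v → Repeats (φ v ∘ σ))
repeating-subfamily {r} {K} {u = u} enc r<u φ = σ , σ-inj , repeats
  where
  c = proj₁ (enc φ)
  mated = common-mate (λ i y → c i (y ↑ˡ u)) (n<1+n (r * K))
  x = proj₁ mated
  L : Fin (suc r) → Fin (suc (r * K))
  L zero    = x
  L (suc i) = proj₁ (proj₂ mated i)
  through = injection-through r<u L
  σ = proj₁ through
  σ-inj = proj₁ (proj₂ through)
  covers = proj₂ (proj₂ through)
  repeats : ∀ v → Repeats (φ v ∘ σ)
  repeats v =
    let i , φᵥ≼cᵢ    = proj₂ (enc φ) v
        l , σl≡x     = covers zero
        l′ , σl′≡y   = covers (suc i)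
        y≢x , cy≡cx = proj₂ (proj₂ mated i)
    in l′ , l , (λ l′≡l → y≢x (↑ˡ-injective u _ _ (trans (sym σl′≡y) (trans (cong σ l′≡l) σl≡x))))
            , φᵥ≼cᵢ _ _ (trans (cong (c i) σl′≡y) (trans cy≡cx (cong (c i) (sym σl≡x))))

matchingCopy : ∀ {E : Set} {n t} (π : E × Fin 2 → Fin n) → Injective _≡_ _≡_ π →
               (ε : Fin t → E) → Injective _≡_ _≡_ ε → MatchingCopy n t
matchingCopy π π-inj ε ε-inj = record
  { emb = λ (l , b) → π (ε l , b)
  ; inj = λ eq → let l≡ , b≡ = ,-injective (π-inj eq) in cong₂ _,_ (ε-inj l≡) b≡
  }

repeats⇒¬rainbow : ∀ {n k t} {c : EdgeColouring n k} {T : MatchingCopy n t} →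
                   Repeats (λ l → col c (end₀ T l) (end₁ T l)) → ¬ Rainbow c T
repeats⇒¬rainbow (l , l′ , l≢l′ , same) rainbow = rainbow l l′ l≢l′ same

pairEnd : ∀ {m} R → Fin m → Fin 2 → Fin (m * 2 + R)
pairEnd R i b = combine i b ↑ˡ R

outer : ∀ m {R} → Fin R → Fin (m * 2 + R)
outer m w = (m * 2) ↑ʳ w

endpoint : ∀ {m R P} → (Fin P × Fin 2 → Fin R) → (Fin m ⊎ Fin P) × Fin 2 → Fin (m * 2 + R)
endpoint {R = R} g (inj₁ i , b) = pairEnd R i b
endpoint {m}     g (inj₂ p , b) = outer m (g (p , b))

endpoint-injective : ∀ {m R P} {g : Fin P × Fin 2 → Fin R} → Injective _≡_ _≡_ g →
                     Injective _≡_ _≡_ (endpoint {m} g)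
endpoint-injective {m} {R} _ {inj₁ i , b} {inj₁ i′ , b′} eq =
  let i≡ , b≡ = combine-injective i b i′ b′ (↑ˡ-injective R _ _ eq) in cong₂ _,_ (cong inj₁ i≡) b≡
endpoint-injective _ {inj₁ _ , _} {inj₂ _ , _} eq = contradiction eq (↑ˡ≢↑ʳ _ _)
endpoint-injective _ {inj₂ _ , _} {inj₁ _ , _} eq = contradiction (sym eq) (↑ˡ≢↑ʳ _ _)
endpoint-injective {m} g-inj {inj₂ p , b} {inj₂ p′ , b′} eq =
  let p≡ , b≡ = ,-injective (g-inj (↑ʳ-injective (m * 2) _ _ eq)) in cong₂ _,_ (cong inj₂ p≡) b≡

edges : ∀ {m P u} → Fin m → Fin m → (Fin u → Fin P) → Fin (2 + u) → Fin m ⊎ Fin P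
edges i j σ zero          = inj₁ i
edges i j σ (suc zero)    = inj₁ j
edges i j σ (suc (suc l)) = inj₂ (σ l)

edges-injective : ∀ {m P u} {i j : Fin m} {σ : Fin u → Fin P} → j ≢ i → Injective _≡_ _≡_ σ →
                  Injective _≡_ _≡_ (edges i j σ)
edges-injective j≢i σ-inj {zero}          {zero}           _  = refl
edges-injective j≢i σ-inj {zero}          {suc zero}       eq = contradiction (sym (inj₁-injective eq)) j≢i
edges-injective j≢i σ-inj {suc zero}      {zero}           eq = contradiction (inj₁-injective eq) j≢i
edges-injective j≢i σ-inj {suc zero}      {suc zero}       _  = refl
edges-injective j≢i σ-inj {suc (suc l)}   {suc (suc l′)}   eq with refl ← σ-inj (inj₂-injective eq) = refl
edges-injective j≢i σ-inj {zero}          {suc (suc _)}    ()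
edges-injective j≢i σ-inj {suc zero}      {suc (suc _)}    ()
edges-injective j≢i σ-inj {suc (suc _)}   {zero}           ()
edges-injective j≢i σ-inj {suc (suc _)}   {suc zero}       ()

¬works : ∀ {r K k u m d} R .{{_ : NonZero m}} → Encodes r K k → r < u → d + k ≤ m →
            m * m * ((suc (r * K) + u) * 2) ≤ R * d → ¬ Works (m * 2 + R) (2 + u) k
¬works {r} {K} {k} {u} {m} {d} R enc r<u d+k≤m enough (f , some-vertex-rainbow) =
  let v , v∈T , rainbow = some-vertex-rainbow T in no-rainbow v v∈T rainbow
  where
  P = suc (r * K) + u
  h : Fin R → Fin m → Fin k
  h w i = col (f (outer m w)) (pairEnd R i zero) (pairEnd R i (suc zero))
  popular = popular-pair d h d+k≤m
  i = proj₁ popular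
  j = proj₁ (proj₂ popular)
  many-alike : P * 2 ≤ count (λ w → mate? (h w) i j)
  many-alike = *-cancelˡ-≤ (m * m) {{m*n≢0 m m}} (≤-trans enough (proj₂ (proj₂ popular)))
  alike = ≤count⇒injection (λ w → mate? (h w) i j) (P * 2) many-alike
  g₀ = proj₁ alike
  g₀-mate = proj₂ (proj₂ alike)
  g : Fin P × Fin 2 → Fin R
  g (p , b) = g₀ (combine p b)
  g-inj : Injective _≡_ _≡_ g
  g-inj eq = let p≡ , b≡ = combine-injective _ _ _ _ (proj₁ (proj₂ alike) eq) in cong₂ _,_ p≡ b≡
  pair : Fin 2 → Fin m
  pair zero       = i
  pair (suc zero) = j
  φ : Fin 2 × Fin 2 → Fin P → Fin k
  φ (e , b) p = col (f (pairEnd R (pair e) b)) (outer m (g (p , zero))) (outer m (g (p , suc zero)))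
  subfamily = repeating-subfamily enc r<u φ
  σ = proj₁ subfamily
  j≢i : j ≢ i
  j≢i = proj₁ (g₀-mate zero)
  T : MatchingCopy (m * 2 + R) (2 + u)
  T = matchingCopy (endpoint g) (endpoint-injective g-inj) (edges i j σ)
                   (edges-injective {i = i} {j} {σ} j≢i (proj₁ (proj₂ subfamily)))
  no-rainbow : ∀ v → InCopy v T → ¬ Rainbow (f v) T
  no-rainbow v ((zero , b) , refl) =
    repeats⇒¬rainbow {c = f v} {T} (repeats-∘ {s = 2 ↑ʳ_} (↑ʳ-injective 2 _ _) (proj₂ (proj₂ subfamily) (zero , b)))
  no-rainbow v ((suc zero , b) , refl) =
    repeats⇒¬rainbow {c = f v} {T} (repeats-∘ {s = 2 ↑ʳ_} (↑ʳ-injective 2 _ _) (proj₂ (proj₂ subfamily) (suc zero , b)))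
  no-rainbow v ((suc (suc l) , b) , refl) =
    repeats⇒¬rainbow {c = f v} {T} (suc zero , zero , (λ ()) , proj₂ (g₀-mate (combine (σ l) b)))

threshold : ℕ → ℕ → ℕ
threshold k P = (k + k) * 2 + (k + k) * 2 * (P * 2)

works⇒≤threshold : ∀ {r K u} n k → Encodes r K (suc k) → r < u → Works n (2 + u) (suc k) →
                   n ≤ threshold (suc k) (suc (r * K) + u)
works⇒≤threshold {r} {K} {u} n k enc r<u works = ≮⇒≥ λ threshold<n →
  ¬works R enc r<u ≤-refl (enough threshold<n) (subst (λ n → Works n (2 + u) (suc k)) (sym (n≡ threshold<n)) works)
  where
  m = suc k + suc k
  P = suc (r * K) + u
  R = n ∸ m * 2
  n≡ : threshold (suc k) P < n → m * 2 + R ≡ n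
  n≡ threshold<n = m+[n∸m]≡n (≤-trans (m≤m+n (m * 2) _) (<⇒≤ threshold<n))
  square-split : ∀ a s → (a + a) * (a + a) * s ≡ (a + a) * 2 * s * a
  square-split = solve-∀
  enough : threshold (suc k) P < n → m * m * (P * 2) ≤ R * suc k
  enough threshold<n = begin
    m * m * (P * 2)         ≡⟨ square-split (suc k) (P * 2) ⟩
    m * 2 * (P * 2) * suc k ≤⟨ *-monoˡ-≤ (suc k) (+-cancelˡ-≤ (m * 2) _ _ threshold≤m*2+R) ⟩
    R * suc k               ∎
    where
    threshold≤m*2+R : threshold (suc k) P ≤ m * 2 + R
    threshold≤m*2+R = ≤-trans (<⇒≤ threshold<n) (≤-reflexive (sym (n≡ threshold<n)))
    open ≤-Reasoning

threshold≤ : ∀ {r u e} K k .{{_ : NonZero k}} → K ≤ k ^ e →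
             threshold k (suc (r * K) + u) ≤ (4 + 8 * (1 + r + u)) * k ^ suc e
threshold≤ {r} {u} {e} K k K≤x = begin
  (k + k) * 2 + (k + k) * 2 * (P * 2)
    ≤⟨ +-mono-≤ (m≤m*n ((k + k) * 2) x) (*-monoʳ-≤ ((k + k) * 2) (*-monoˡ-≤ 2 P≤)) ⟩
  (k + k) * 2 * x + (k + k) * 2 * ((1 + r + u) * x * 2)
    ≡⟨ collect k x (1 + r + u) ⟩
  (4 + 8 * (1 + r + u)) * (k * x)
    ∎
  where
  open ≤-Reasoning
  x = k ^ e
  instance
    x≢0 : NonZero x
    x≢0 = m^n≢0 k e
  P = suc (r * K) + u
  factor : ∀ y a b → y + a * y + b * y ≡ (1 + a + b) * y
  factor = solve-∀
  P≤ : P ≤ (1 + r + u) * x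
  P≤ = begin
    1 + r * K + u          ≤⟨ +-mono-≤ (+-mono-≤ (>-nonZero⁻¹ x) (*-monoʳ-≤ r K≤x)) (m≤m*n u x) ⟩
    x + r * x + u * x      ≡⟨ factor x r u ⟩
    (1 + r + u) * x        ∎
  collect : ∀ a y c → (a + a) * 2 * y + (a + a) * 2 * (c * y * 2) ≡ (4 + 8 * c) * (a * y)
  collect = solve-∀

lowerBoundRoot : ∀ {r u} e (K : ℕ → ℕ) → r < u → (∀ k → Encodes r (K k) k) → (∀ k → K k ≤ k ^ e) →
             LowerBoundRoot (2 + u) (suc e)
lowerBoundRoot {r} {u} e K r<u enc K≤ = 4 + 8 * (1 + r + u) , 1 , bound
  where
  bound : ∀ n → 1 ≤ n → ∀ k → Works n (2 + u) k → n ≤ (4 + 8 * (1 + r + u)) * k ^ suc e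
  bound (suc _) _ zero    (f , _) with () ← col (f zero) zero zero
  bound n       _ (suc k) works   =
    ≤-trans (works⇒≤threshold n k (enc (suc k)) r<u works) (threshold≤ {r} {u} {e} (K (suc k)) (suc k) (K≤ (suc k)))

theorem6 : LowerBoundRoot 4 5 × LowerBoundRoot 5 3 × LowerBoundRoot 6 3
           × (∀ t → 7 ≤ t → LowerBoundRoot t 2)
theorem6 = lowerBoundRoot 4 (λ k → k * k * (k * k)) (n<1+n 1) (λ _ → encodes-halve (encodes-halve {2} encodes-identity)) k⁴
         , lowerBoundRoot 2 (λ k → k * k) (n<1+n 2) (λ _ → encodes-halve {2} encodes-identity) k²
         , lowerBoundRoot 2 (λ k → k * k) (s≤s (s≤s (s≤s z≤n))) (λ _ → encodes-halve {2} encodes-identity) k²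
         , λ { (suc (suc u)) (s≤s (s≤s 5≤u)) → lowerBoundRoot 1 (λ k → k) 5≤u (λ _ → encodes-identity) k¹ }
  where
  k⁴ : ∀ k → k * k * (k * k) ≤ k ^ 4
  k⁴ k = ≤-reflexive (square-of-square k)
    where
    square-of-square : ∀ k → k * k * (k * k) ≡ k * (k * (k * (k * 1)))
    square-of-square = solve-∀
  k² : ∀ k → k * k ≤ k ^ 2
  k² k = ≤-reflexive (cong (k *_) (sym (*-identityʳ k)))
  k¹ : ∀ k → k ≤ k ^ 1
  k¹ k = ≤-reflexive (sym (*-identityʳ k))
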